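{- For every $n\ge 4$, the wheel graph $W_n$ on $n$ vertices satisfies $\lambda(W_n)=n$.
   Context: The wheel $W_n$ is the join $C_{n-1}\nabla K_1$ of a cycle on $n-1$ vertices with a single vertex (the hub), which is adjacent to all cycle vertices. For a $k$-coloring $c:V(G)\to\{1,\dots,k\}$, the induced edge coloring is $c'(\{u,v\})=\{c(u),c(v)\}$ (a multiset); $c$ is edge-distinguishing if $c'$ is injective, and $\lambda(G)$ (the edge-distinguishing chromatic number) is the least $k$ admitting an edge-distinguishing $k$-coloring. -}

module Defs where

open import Data.Nat using (ℕ; _<_) renaming (suc to sucℕ)
open import Data.Fin using (Fin; zero; suc; toℕ)
open import Data.Empty using (⊥)
open import Data.Unit using (⊤)
open import Data.Product using (_×_; Σ; ∃; ∃-syntax; _,_)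
open import Data.Sum using (_⊎_)
open import Relation.Binary.PropositionalEquality using (_≡_)
open import Relation.Nullary using (¬_)

-- A (simple, finite) graph on the vertex set Fin v, given by its adjacency
-- relation (edges are the unordered pairs {u,w} with Adj u w).
record Graph : Set₁ where
  field
    nV  : ℕ
    Adj : Fin nV → Fin nV → Set

open Graph public

UPairEq : {A : Set} → A → A → A → A → Set
UPairEq a b c d = (a ≡ c × b ≡ d) ⊎ (a ≡ d × b ≡ c)

-- A k-coloring c : V(G) → {1..k} (colors represented by Fin k) is
-- edge-distinguishing if the induced edge coloring {u,w} ↦ {c u, c w}
-- (multiset) is injective on edges.
EdgeDistinguishing : (G : Graph) (k : ℕ) → (Fin (nV G) → Fin k) → Set
EdgeDistinguishing G k c =
  ∀ u w x y → Adj G u w → Adj G x y →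
  UPairEq (c u) (c w) (c x) (c y) → UPairEq u w x y

HasEdgeDistChromaticNumber : Graph → ℕ → Set
HasEdgeDistChromaticNumber G k =
  (Σ (Fin (nV G) → Fin k) (EdgeDistinguishing G k)) ×
  (∀ j → j < k → ¬ Σ (Fin (nV G) → Fin j) (EdgeDistinguishing G j))

CycleAdj : (m : ℕ) → Fin m → Fin m → Set
CycleAdj m i j = (sucℕ (toℕ i) ≡ toℕ j ⊎ sucℕ (toℕ j) ≡ toℕ i)
               ⊎ ((sucℕ (toℕ i) ≡ m × toℕ j ≡ 0) ⊎ (sucℕ (toℕ j) ≡ m × toℕ i ≡ 0))

-- Adjacency of the join C_m ∇ K_1: vertex zero is the hub, suc i is cycle
-- vertex i.
WheelAdj : (m : ℕ) → Fin (sucℕ m) → Fin (sucℕ m) → Set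
WheelAdj m zero    zero    = ⊥
WheelAdj m zero    (suc j) = ⊤
WheelAdj m (suc i) zero    = ⊤
WheelAdj m (suc i) (suc j) = CycleAdj m i j

Wheel : (n : ℕ) → Graph
Wheel 0       = record { nV = 0 ; Adj = λ () }
Wheel (sucℕ m) = record { nV = sucℕ m ; Adj = WheelAdj m }

{-# OPTIONS --safe #-}
module Submission where

open import Defs
open import Data.Nat using (ℕ; _≤_; _<?_)
open import Data.Nat.Properties using (≤-antisym; ≮⇒≥)
open import Data.Fin using (Fin; zero; suc; toℕ; fromℕ<)
open import Data.Fin.Properties using (_≟_; toℕ<n; toℕ-fromℕ<; <⇒notInjective)
open import Data.Product using (_×_; ∃-syntax; _,_)
open import Data.Sum using (inj₁; inj₂)
open import Data.Empty using (⊥-elim)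
open import Data.Unit using (tt)
open import Function using (id)
open import Function.Definitions using (Injective)
open import Relation.Nullary using (yes; no)
open import Relation.Binary.PropositionalEquality using (_≡_; _≢_; refl; sym; trans; cong)

-- Any injective colouring is edge-distinguishing, and if every
-- edge-distinguishing colouring is injective then λ(G) is the number of
-- vertices.  The latter holds as soon as some hub h is adjacent to all
-- other vertices, each of which has a neighbour besides h: two rim
-- vertices of the same colour give the equally coloured spokes to them,
-- and a rim vertex v coloured like h, with neighbour w ≠ h, gives the
-- equally coloured edges {v,w} and {h,w}.

Colouring : Graph → ℕ → Set
Colouring G k = Fin (nV G) → Fin k

injective⇒edgeDistinguishing : ∀ G {k} (c : Colouring G k) →
  Injective _≡_ _≡_ c → EdgeDistinguishing G k c
injective⇒edgeDistinguishing G c inj u w x y _ _ (inj₁ (cu≡cx , cw≡cy)) =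
  inj₁ (inj cu≡cx , inj cw≡cy)
injective⇒edgeDistinguishing G c inj u w x y _ _ (inj₂ (cu≡cy , cw≡cx)) =
  inj₂ (inj cu≡cy , inj cw≡cx)

edgeDistChromaticNumber≡nV : ∀ G →
  (∀ k (c : Colouring G k) → EdgeDistinguishing G k c → Injective _≡_ _≡_ c) →
  HasEdgeDistChromaticNumber G (nV G)
edgeDistChromaticNumber≡nV G edgeDist⇒inj =
    (id , injective⇒edgeDistinguishing G id id)
  , λ j j<n (c , ed) → <⇒notInjective j<n (edgeDist⇒inj j c ed)

record IsHub (G : Graph) (h : Fin (nV G)) : Set where
  field
    spoke : ∀ v → v ≢ h → Adj G h v
    rim   : ∀ v → v ≢ h → ∃[ w ] (w ≢ h × Adj G v w)

module _ {G : Graph} {h : Fin (nV G)} (isHub : IsHub G h)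
         {k : ℕ} {c : Colouring G k} (ed : EdgeDistinguishing G k c) where

  open IsHub isHub

  hubColour-unique : ∀ v → c v ≡ c h → v ≡ h
  hubColour-unique v cv≡ch with v ≟ h
  ... | yes v≡h = v≡h
  ... | no  v≢h with rim v v≢h
  ...   | w , w≢h , v~w with ed v w h w v~w (spoke w w≢h) (inj₁ (cv≡ch , refl))
  ...     | inj₁ (v≡h , _) = v≡h
  ...     | inj₂ (_ , w≡h) = ⊥-elim (w≢h w≡h)

  rimColouring-injective : ∀ u v → u ≢ h → v ≢ h → c u ≡ c v → u ≡ v
  rimColouring-injective u v u≢h v≢h cu≡cv
    with ed h u h v (spoke u u≢h) (spoke v v≢h) (inj₁ (refl , cu≡cv))
  ... | inj₁ (_ , u≡v) = u≡v
  ... | inj₂ (h≡v , _) = ⊥-elim (v≢h (sym h≡v))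

  hub⇒injective : Injective _≡_ _≡_ c
  hub⇒injective {u} {v} cu≡cv with u ≟ h | v ≟ h
  ... | yes u≡h | _       = trans u≡h (sym (hubColour-unique v (trans (sym cu≡cv) (cong c u≡h))))
  ... | no  _   | yes v≡h = trans (hubColour-unique u (trans cu≡cv (cong c v≡h))) (sym v≡h)
  ... | no  u≢h | no  v≢h = rimColouring-injective u v u≢h v≢h cu≡cv

cycle-successor : ∀ {m} (i : Fin m) → ∃[ j ] CycleAdj m i j
cycle-successor {ℕ.suc m} i with ℕ.suc (toℕ i) <? ℕ.suc m
... | yes i+1<m = fromℕ< i+1<m , inj₁ (inj₁ (sym (toℕ-fromℕ< i+1<m)))
... | no  i+1≮m = zero , inj₂ (inj₁ (≤-antisym (toℕ<n i) (≮⇒≥ i+1≮m) , refl))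

wheel-isHub : ∀ m → IsHub (Wheel (ℕ.suc m)) zero
wheel-isHub m = record { spoke = spoke ; rim = rim }
  where
  spoke : ∀ v → v ≢ zero → WheelAdj m zero v
  spoke zero    0≢0 = ⊥-elim (0≢0 refl)
  spoke (suc i) _   = tt

  rim : ∀ v → v ≢ zero → ∃[ w ] (w ≢ zero × WheelAdj m v w)
  rim zero    0≢0 = ⊥-elim (0≢0 refl)
  rim (suc i) _   with cycle-successor i
  ... | j , i~j = suc j , (λ ()) , i~j

lemma3p4 : (n : ℕ) → 4 ≤ n → HasEdgeDistChromaticNumber (Wheel n) n
lemma3p4 (ℕ.suc m) _ =
  edgeDistChromaticNumber≡nV (Wheel (ℕ.suc m)) (λ _ _ → hub⇒injective (wheel-isHub m))
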